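{- Let $k\ge 3$ be an integer. Neither a $(k,k+1)$-cleared oriented graph nor a $(k,2k-1)$-cleared oriented graph contains a transitive triangle.
   Context: An oriented graph is a directed graph without loops in which every pair of vertices is joined by at most one arc. $\overrightarrow{C}_m$ denotes the directed cycle of length $m$. The transitive triangle is the oriented graph on vertices $v_1,v_2,v_3$ with arcs $v_1v_2,v_2v_3,v_1v_3$. An oriented graph $G$ contains a homomorphic image of $\overrightarrow{C}_\ell$ if there is a map $\varphi:V(\overrightarrow{C}_\ell)\to V(G)$ sending arcs to arcs, i.e. $G$ contains a closed directed walk of length $\ell$. For integers $k,\ell\ge 3$ with $k\nmid\ell$, an oriented graph $G$ is $(k,\ell)$-cleared if it contains no homomorphic image of $\overrightarrow{C}_\ell$ and every arc and every vertex of $G$ lies in some copy of $\overrightarrow{C}_k$. -}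

module Defs where

open import Data.Nat using (ℕ; suc; _+_)
open import Data.Nat.DivMod using (_mod_)
open import Data.Fin using (Fin; toℕ)
open import Data.Product using (Σ; ∃; _×_; _,_)
open import Relation.Nullary using (¬_)
open import Data.Empty using (⊥)
open import Relation.Binary.PropositionalEquality using (_≡_)
open import Function.Definitions using (Injective)

record OrientedGraph : Set₁ where
  field
    n        : ℕ
    Arc      : Fin n → Fin n → Set
    noLoop   : ∀ v → ¬ Arc v v
    oriented : ∀ u v → Arc u v → ¬ Arc v u

open OrientedGraph public

next : ∀ {m} → Fin (suc m) → Fin (suc m)
next {m} i = (suc (toℕ i)) mod (suc m)

-- The directed cycle C_m has vertices Fin m and arcs i → next i (m ≥ 1 here).
-- A homomorphism C_m → G: a map sending arcs to arcs.
IsHom : (G : OrientedGraph) (m : ℕ) → (Fin (suc m) → Fin (n G)) → Set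
IsHom G m f = ∀ (i : Fin (suc m)) → Arc G (f i) (f (next i))

HasHomImage : OrientedGraph → ℕ → Set
HasHomImage G 0 = ⊥  -- never used: cycles have length ≥ 1
HasHomImage G (suc m) = Σ (Fin (suc m) → Fin (n G)) (IsHom G m)

IsCopy : (G : OrientedGraph) (m : ℕ) → (Fin (suc m) → Fin (n G)) → Set
IsCopy G m f = IsHom G m f × Injective _≡_ _≡_ f

Cleared : OrientedGraph → ℕ → ℕ → Set
Cleared G 0 ℓ = ⊥  -- never used: k ≥ 3
Cleared G (suc m) ℓ =
  ¬ HasHomImage G ℓ
  × (∀ u v → Arc G u v →
       ∃ λ (f : Fin (suc m) → Fin (n G)) → IsCopy G m f ×
         ∃ λ i → f i ≡ u × f (next i) ≡ v)
  × (∀ v → ∃ λ (f : Fin (suc m) → Fin (n G)) → IsCopy G m f ×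
         ∃ λ i → f i ≡ v)

HasTransitiveTriangle : OrientedGraph → Set
HasTransitiveTriangle G =
  ∃ λ v₁ → ∃ λ v₂ → ∃ λ v₃ → Arc G v₁ v₂ × Arc G v₂ v₃ × Arc G v₁ v₃

-- Let v₁ → v₂ → v₃ and v₁ → v₃ form a transitive triangle. Every arc uv lying on a
-- copy of C_k comes with a walk of length k − 1 from v back to u. Replacing the arc
-- v₁v₃ of its cycle by v₁v₂v₃ gives a closed walk of length k + 1; going v₁ → v₃,
-- around the cycle of v₂v₃ back to v₂, then around the cycle of v₁v₂ back to v₁,
-- gives one of length 1 + 2(k − 1) = 2k − 1.
module Submission where

open import Defs
open import Data.Nat using (ℕ; zero; suc; _≤_; _<_; _+_; _∸_; _*_; _%_; NonZero; s≤s)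
open import Data.Nat.Properties using (+-comm; +-suc; +-identityʳ; m≤n⇒m<n∨m≡n)
open import Data.Nat.DivMod using (n%n≡0; m<n⇒m%n≡m; m%n<n; [m+n]%n≡m%n; %-distribˡ-+; m%n%n≡m%n; %-congˡ)
open import Data.Nat.GeneralisedArithmetic using (iterate)
open import Data.Fin using (Fin; toℕ)
open import Data.Fin.Properties using (toℕ-injective; toℕ<n; toℕ-fromℕ<)
open import Data.Product using (∃; _×_; _,_)
open import Data.Sum using (_⊎_; inj₁; inj₂)
open import Relation.Nullary using (¬_)
open import Relation.Binary.PropositionalEquality

toℕ-next : ∀ {m} (i : Fin (suc m)) → toℕ (next i) ≡ suc (toℕ i) % suc m
toℕ-next {m} i = toℕ-fromℕ< (m%n<n (suc (toℕ i)) (suc m))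

toℕ-iterate-next : ∀ {m} (i : Fin (suc m)) p → toℕ (iterate next i p) ≡ (toℕ i + p) % suc m
toℕ-iterate-next {m} i zero = begin
  toℕ i              ≡⟨ m<n⇒m%n≡m (toℕ<n i) ⟨
  toℕ i % suc m      ≡⟨ %-congˡ (+-identityʳ (toℕ i)) ⟨
  (toℕ i + 0) % suc m ∎
  where open ≡-Reasoning
toℕ-iterate-next {m} i (suc p) = begin
  toℕ (iterate next (next i) p)          ≡⟨ toℕ-iterate-next (next i) p ⟩
  (toℕ (next i) + p) % s                 ≡⟨ %-congˡ (cong (_+ p) (toℕ-next i)) ⟩
  (suc (toℕ i) % s + p) % s              ≡⟨ %-distribˡ-+ (suc (toℕ i) % s) p s ⟩
  (suc (toℕ i) % s % s + p % s) % s      ≡⟨ %-congˡ (cong (_+ p % s) (m%n%n≡m%n (suc (toℕ i)) s)) ⟩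
  (suc (toℕ i) % s + p % s) % s          ≡⟨ %-distribˡ-+ (suc (toℕ i)) p s ⟨
  (suc (toℕ i) + p) % s                  ≡⟨ %-congˡ (+-suc (toℕ i) p) ⟨
  (toℕ i + suc p) % s                    ∎
  where
  open ≡-Reasoning
  s = suc m

iterate-next-period : ∀ {m} (i : Fin (suc m)) → iterate next i (suc m) ≡ i
iterate-next-period {m} i = toℕ-injective (begin
  toℕ (iterate next i (suc m)) ≡⟨ toℕ-iterate-next i (suc m) ⟩
  (toℕ i + suc m) % suc m      ≡⟨ [m+n]%n≡m%n (toℕ i) (suc m) ⟩
  toℕ i % suc m                ≡⟨ m<n⇒m%n≡m (toℕ<n i) ⟩
  toℕ i                        ∎)
  where open ≡-Reasoning

module WalksIn (G : OrientedGraph) where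
  private
    V = Fin (n G)

  infixr 5 _∷_ _++_

  data Walk : V → V → ℕ → Set where
    []  : ∀ {u} → Walk u u 0
    _∷_ : ∀ {u v w ℓ} → Arc G u v → Walk v w ℓ → Walk u w (suc ℓ)

  _++_ : ∀ {u v w ℓ ℓ′} → Walk u v ℓ → Walk v w ℓ′ → Walk u w (ℓ + ℓ′)
  []      ++ q = q
  (a ∷ p) ++ q = a ∷ (p ++ q)

  -- Indices beyond the length are junk and return the start vertex.
  vertexAt : ∀ {u v ℓ} → Walk u v ℓ → ℕ → V
  vertexAt {u} _       zero    = u
  vertexAt {u} []      (suc _) = u
  vertexAt     (_ ∷ p) (suc i) = vertexAt p i

  vertexAt-length : ∀ {u v ℓ} (p : Walk u v ℓ) → vertexAt p ℓ ≡ v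
  vertexAt-length []      = refl
  vertexAt-length (_ ∷ p) = vertexAt-length p

  arcAt : ∀ {u v ℓ i} (p : Walk u v ℓ) → i < ℓ → Arc G (vertexAt p i) (vertexAt p (suc i))
  arcAt {i = zero}  (a ∷ _) _         = a
  arcAt {i = suc i} (_ ∷ p) (s≤s i<ℓ) = arcAt p i<ℓ

  vertexAt-closed-% : ∀ {u ℓ j} .{{_ : NonZero ℓ}} (p : Walk u u ℓ) → j ≤ ℓ →
                      vertexAt p (j % ℓ) ≡ vertexAt p j
  vertexAt-closed-% {ℓ = ℓ} p j≤ℓ with m≤n⇒m<n∨m≡n j≤ℓ
  ... | inj₁ j<ℓ  = cong (vertexAt p) (m<n⇒m%n≡m j<ℓ)
  ... | inj₂ refl = trans (cong (vertexAt p) (n%n≡0 ℓ)) (sym (vertexAt-length p))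

  closedWalk⇒homImage : ∀ {u m} → Walk u u (suc m) → HasHomImage G (suc m)
  closedWalk⇒homImage {m = m} p = f , isHom
    where
    f : Fin (suc m) → V
    f i = vertexAt p (toℕ i)

    isHom : IsHom G m f
    isHom i = subst (Arc G (f i)) onNext (arcAt p (toℕ<n i))
      where
      onNext : vertexAt p (suc (toℕ i)) ≡ f (next i)
      onNext = trans (sym (vertexAt-closed-% p (toℕ<n i))) (cong (vertexAt p) (sym (toℕ-next i)))

  walkAlongHom : ∀ {m f} → IsHom G m f → ∀ i p → Walk (f i) (f (iterate next i p)) p
  walkAlongHom h i zero    = []
  walkAlongHom h i (suc p) = h i ∷ walkAlongHom h (next i) p

  returnWalk : ∀ {m f} → IsHom G m f → ∀ i → Walk (f (next i)) (f i) m
  returnWalk {m} {f} h i = subst (λ w → Walk (f (next i)) w m) (cong f (iterate-next-period i))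
                                 (walkAlongHom h (next i) m)

  arcOnCycle⇒returnWalk : ∀ {m u v} →
    (∃ λ (f : Fin (suc m) → V) → IsCopy G m f × ∃ λ i → f i ≡ u × f (next i) ≡ v) →
    Walk v u m
  arcOnCycle⇒returnWalk (f , (h , _) , i , refl , refl) = returnWalk h i

2[1+m]∸1≡1+[m+m] : ∀ m → 2 * suc m ∸ 1 ≡ suc (m + m)
2[1+m]∸1≡1+[m+m] m = trans (+-suc m (m + 0)) (cong (λ x → suc (m + x)) (+-identityʳ m))

mainTheorem17 : (k : ℕ) → 3 ≤ k → (G : OrientedGraph) →
    (Cleared G k (k + 1) ⊎ Cleared G k (2 * k ∸ 1)) → ¬ HasTransitiveTriangle G
mainTheorem17 (suc m) _ G (inj₁ (noHom , onCycle , _)) (v₁ , v₂ , v₃ , a₁₂ , a₂₃ , a₁₃) =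
  noHom (subst (HasHomImage G) (sym (+-comm (suc m) 1))
    (closedWalk⇒homImage (a₁₂ ∷ a₂₃ ∷ back₃₁)))
  where
  open WalksIn G

  back₃₁ : Walk v₃ v₁ m
  back₃₁ = arcOnCycle⇒returnWalk (onCycle v₁ v₃ a₁₃)
mainTheorem17 (suc m) _ G (inj₂ (noHom , onCycle , _)) (v₁ , v₂ , v₃ , a₁₂ , a₂₃ , a₁₃) =
  noHom (subst (HasHomImage G) (sym (2[1+m]∸1≡1+[m+m] m))
    (closedWalk⇒homImage (a₁₃ ∷ back₃₂ ++ back₂₁)))
  where
  open WalksIn G

  back₃₂ : Walk v₃ v₂ m
  back₃₂ = arcOnCycle⇒returnWalk (onCycle v₂ v₃ a₂₃)
  back₂₁ : Walk v₂ v₁ m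
  back₂₁ = arcOnCycle⇒returnWalk (onCycle v₁ v₂ a₁₂)
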